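{- Let $p=\sum_{i=1}^n a_ix_i+a_0$ be a strongly admissible pattern and let $m$ be a $p$-admissible multiplicity. Then $\mathcal S_m(p)$ contains infinitely many numerical semigroups if and only if $\gcd(m,a_0)\neq 1$.
   Context: A numerical semigroup is a subset $\Lambda\subseteq\mathbb N_0$ containing $0$, closed under addition, with finite complement in $\mathbb N_0$; its multiplicity is its smallest nonzero element. A (nonhomogeneous) pattern is $p(x_1,\dots,x_n)=\sum_{i=1}^n a_ix_i+a_0$ with $a_1,\dots,a_n$ nonzero integers and $a_0$ a nonzero integer; $\Lambda$ admits $p$ if $p(s_1,\dots,s_n)\in\Lambda$ for all nonzero $s_1\geq\cdots\geq s_n$ in $\Lambda$. $\mathcal S_m(p)$ is the set of numerical semigroups of multiplicity $m$ admitting $p$. Put $\sigma_j=\sum_{i=1}^j a_i$. $p$ is admissible if $\sigma_j\geq 0$ for all $j\le n$ and either $a_0\geq 0$ or $\sigma_n>1$. A positive integer $m$ is a $p$-admissible multiplicity if $m\geq -a_0/(\sigma_n-1)$ when $\sigma_n>1$, no condition when $\sigma_n=1$, and $m\le a_0$ when $\sigma_n=0$. For admissible $p$ (so $a_1\geq1$) define $p'=p-x_1$ if $a_1>1$ and $p'=p(0,x_1,\dots,x_{n-1})$ if $a_1=1$; let $\sigma'_j$ be the partial sums of the coefficients of the variables of $p'$. $p$ is strongly admissible if it is admissible and all $\sigma'_j\geq 0$. -}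

module Defs where

open import Data.Nat as ℕ using (ℕ; zero; suc)
open import Data.Integer as ℤ using (ℤ; +_; -[1+_])
open import Data.Bool using (Bool; true; false)
open import Data.Fin using (Fin)
import Data.Fin as Fin
open import Data.Vec using (Vec; []; _∷_; lookup; toList)
open import Data.List using (List; []; _∷_)
open import Data.List.Membership.Propositional using (_∈_)
open import Data.Product using (Σ; ∃; _×_; _,_)
open import Data.Sum using (_⊎_)
open import Relation.Nullary using (¬_; yes; no)
open import Relation.Binary.PropositionalEquality using (_≡_)

-- Numerical semigroups, given by (decidable) membership  mem : ℕ → Bool.
-- (Every numerical semigroup has decidable membership, since its
-- complement in ℕ₀ is finite.)

record NumericalSemigroup : Set where
  field
    mem        : ℕ → Bool
    zero∈      : mem 0 ≡ true
    closed     : ∀ x y → mem x ≡ true → mem y ≡ true → mem (x ℕ.+ y) ≡ true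
    cofinite   : Σ ℕ λ F → ∀ x → F ℕ.≤ x → mem x ≡ true
open NumericalSemigroup public

_∈ℤ_ : ℤ → NumericalSemigroup → Set
(+ k)    ∈ℤ Λ = mem Λ k ≡ true
-[1+ k ] ∈ℤ Λ = Data.Empty.⊥
  where import Data.Empty

HasMultiplicity : NumericalSemigroup → ℕ → Set
HasMultiplicity Λ m =
  (1 ℕ.≤ m) × (mem Λ m ≡ true) × (∀ k → 1 ℕ.≤ k → k ℕ.< m → mem Λ k ≡ false)

_≈NS_ : NumericalSemigroup → NumericalSemigroup → Set
Λ ≈NS Λ' = ∀ x → mem Λ x ≡ mem Λ' x

linear : ∀ {n} → Vec ℤ n → Vec ℕ n → ℤ
linear []       []       = + 0
linear (a ∷ as) (s ∷ ss) = a ℤ.* (+ s) ℤ.+ linear as ss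

evalPattern : ∀ {n} → Vec ℤ n → ℤ → Vec ℕ n → ℤ
evalPattern a a₀ s = linear a s ℤ.+ a₀

Admits : ∀ {n} → NumericalSemigroup → Vec ℤ n → ℤ → Set
Admits {n} Λ a a₀ =
  (s : Vec ℕ n) →
  (∀ i → 1 ℕ.≤ lookup s i) →
  (∀ i → mem Λ (lookup s i) ≡ true) →
  (∀ (i j : Fin n) → i Fin.≤ j → lookup s j ℕ.≤ lookup s i) →
  evalPattern a a₀ s ∈ℤ Λ

InS : ℕ → ∀ {n} → Vec ℤ n → ℤ → NumericalSemigroup → Set
InS m a a₀ Λ = HasMultiplicity Λ m × Admits Λ a a₀

FiniteS : ℕ → ∀ {n} → Vec ℤ n → ℤ → Set
FiniteS m a a₀ =
  Σ (List NumericalSemigroup) λ L →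
    (∀ Λ → Λ ∈ L → InS m a a₀ Λ) ×
    (∀ Λ → InS m a a₀ Λ → Σ NumericalSemigroup λ Λ' → Λ' ∈ L × Λ ≈NS Λ')

InfiniteS : ℕ → ∀ {n} → Vec ℤ n → ℤ → Set
InfiniteS m a a₀ = ¬ FiniteS m a a₀

PartialSumsNonneg : List ℤ → Set
PartialSumsNonneg = go (+ 0)
  where
  go : ℤ → List ℤ → Set
  go acc []       = Data.Unit.⊤
    where import Data.Unit
  go acc (x ∷ xs) = (+ 0 ℤ.≤ acc ℤ.+ x) × go (acc ℤ.+ x) xs

sumCoeffs : ∀ {n} → Vec ℤ n → ℤ
sumCoeffs []       = + 0
sumCoeffs (a ∷ as) = a ℤ.+ sumCoeffs as

IsPattern : ∀ {n} → Vec ℤ n → ℤ → Set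
IsPattern {n} a a₀ = (∀ (i : Fin n) → ¬ lookup a i ≡ + 0) × ¬ a₀ ≡ + 0

Admissible : ∀ {n} → Vec ℤ n → ℤ → Set
Admissible a a₀ =
  PartialSumsNonneg (toList a) × ((+ 0 ℤ.≤ a₀) ⊎ (+ 1 ℤ.< sumCoeffs a))

-- variable coefficients of p′ (for a pattern with n ≥ 1 variables):
--   p′ = p − x₁ if a₁ > 1, and p′ = p(0,x₁,…,x_{n−1}) if a₁ = 1
coeffsPrime : ∀ {k} → Vec ℤ (suc k) → List ℤ
coeffsPrime (a₁ ∷ as) with a₁ ℤ.≟ + 1
... | yes _ = toList as
... | no  _ = (a₁ ℤ.- + 1) ∷ toList as

StronglyAdmissible : ∀ {k} → Vec ℤ (suc k) → ℤ → Set
StronglyAdmissible a a₀ = Admissible a a₀ × PartialSumsNonneg (coeffsPrime a)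

-- m is a p-admissible multiplicity
--   σₙ > 1 : m ≥ −a₀/(σₙ−1)  (equivalently (σₙ−1)·m ≥ −a₀)
--   σₙ = 1 : no condition
--   σₙ = 0 : m ≤ a₀
AdmissibleMultiplicity : ∀ {n} → Vec ℤ n → ℤ → ℕ → Set
AdmissibleMultiplicity a a₀ m =
  (1 ℕ.≤ m) ×
  (+ 1 ℤ.< sumCoeffs a → ℤ.- a₀ ℤ.≤ (sumCoeffs a ℤ.- + 1) ℤ.* (+ m)) ×
  (sumCoeffs a ≡ + 0 → + m ℤ.≤ a₀)

module Submission where

-- Both directions rest on one estimate (module PatternBounds): on every
-- nonincreasing input s₁ ≥ ⋯ ≥ sₙ ≥ m, p(s) is a natural number ≥ s₁.  It comes
-- from writing p(x, s) = x + p′(…) and bounding p′ from below by Abel summation,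
-- which uses that the partial sums of the coefficients of p′ are nonnegative.
--
-- gcd(m, a₀) = d ≠ 1: the semigroups Λ_N = {0} ∪ {x ≥ m : d ∣ x} ∪ [N, ∞) all
-- admit p (a pattern preserves divisibility by d, and by the estimate it never
-- decreases the largest entry), and they have gaps arbitrarily far out, so no
-- finite list can represent all of them.
--
-- gcd(m, a₀) = 1: every Λ ∈ 𝒮ₘ(p) contains m and e = p(m, …, m), and
-- gcd(m, e) = 1; a Bézout identity for m and e then shows that all X ≥ B lie
-- in Λ, for a bound B independent of Λ (module Combinations).  Such a family is
-- classically finite, since Λ is determined by its membership below B; this
-- is proved in the double-negation form that refutes InfiniteS = ¬ FiniteS.

open import Defs
open import Data.Nat as ℕ using (ℕ; zero; suc; z≤n)
open import Data.Nat.Properties using (≤-reflexive)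
open import Data.Nat.Divisibility using (_∣_; _∣0)
open import Data.Nat.GCD using (gcd; gcd[m,n]∣m; gcd[m,n]∣n; gcd-greatest; gcd[m,n]≡0⇒m≡0; module Bézout)
open import Data.Nat.Coprimality using (Coprime; coprime-Bézout)
open import Data.Integer using (ℤ; +_; ∣_∣)
open import Data.Integer.Divisibility.Signed using (∣ᵤ⇒∣; ∣⇒∣ᵤ) renaming (_∣_ to _∣ℤ_)
open import Data.Bool using (Bool; true; false)
import Data.Fin as Fin
open import Data.Fin using (Fin; toℕ; fromℕ<)
open import Data.Fin.Properties using (toℕ-fromℕ<)
open import Data.Vec using (Vec; []; _∷_; lookup; replicate; tabulate)
open import Data.Vec.Properties using (lookup-replicate; lookup∘tabulate)
open import Data.List using (List; []; _∷_; [_]; map; _++_)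
open import Data.List.Membership.Propositional using (_∈_)
open import Data.List.Membership.Propositional.Properties using (∈-map⁺; ∈-++⁺ˡ; ∈-++⁺ʳ)
open import Data.List.Relation.Unary.Any using (here; there)
import Data.List.Relation.Unary.All as All
open import Data.List.Extrema.Nat using (max; xs≤max)
open import Data.Product using (Σ; ∃₂; _×_; _,_; proj₁; proj₂)
open import Data.Sum using (_⊎_; inj₁; inj₂)
open import Data.Empty using (⊥-elim)
open import Function using (_∘_)
open import Relation.Nullary using (¬_; Dec; yes; no; does; contradiction; ¬¬-excluded-middle)
open import Relation.Nullary.Negation using (¬¬-map)
open import Relation.Nullary.Decidable using (dec-true; dec-false; _×-dec_; _⊎-dec_)
open import Relation.Binary.PropositionalEquality using (_≡_; refl; sym; trans; cong; subst; module ≡-Reasoning)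

module PatternBounds where

  open import Data.Integer using (-[1+_]; _+_; _*_; _-_; _≤_; +≤+; nonNegative) renaming (_≟_ to _≟ℤ_)
  open import Data.Integer.Properties
    using (+-identityʳ; +-assoc; *-identityˡ; *-distribʳ-+; +-monoʳ-≤; +-monoˡ-≤; +-mono-≤;
           *-monoˡ-≤-nonNeg; *-monoʳ-≤-nonNeg; i≤j⇒0≤j-i; i≤i+j; neg-involutive; module ≤-Reasoning)
  open import Data.Integer.Tactic.RingSolver using (solve-∀)
  open import Data.Integer.Divisibility.Signed using (∣m∣n⇒∣m+n; ∣m+n∣m⇒∣n; ∣n⇒∣m*n)
  open import Data.Nat using (s≤s)
  open import Data.Vec using (toList)

  AtLeast : ∀ {l} → ℕ → Vec ℕ l → Set
  AtLeast m s = ∀ i → m ℕ.≤ lookup s i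

  -- s₁ ≥ s₂ ≥ ⋯ , in the form in which Admits supplies it
  NonIncreasing : ∀ {l} → Vec ℕ l → Set
  NonIncreasing {l} s = ∀ (i j : Fin l) → i Fin.≤ j → lookup s j ℕ.≤ lookup s i

  nonIncreasing-tail : ∀ {l x} {s : Vec ℕ l} → NonIncreasing (x ∷ s) → NonIncreasing s
  nonIncreasing-tail dec i j i≤j = dec (Fin.suc i) (Fin.suc j) (s≤s i≤j)

  nonIncreasing-head : ∀ {l x y} {s : Vec ℕ l} → NonIncreasing (x ∷ y ∷ s) → y ℕ.≤ x
  nonIncreasing-head dec = dec Fin.zero (Fin.suc Fin.zero) z≤n

  constant-atLeast : ∀ {l} m → AtLeast m (replicate l m)
  constant-atLeast m i = ≤-reflexive (sym (lookup-replicate i m))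

  constant-nonIncreasing : ∀ {l} x → NonIncreasing (replicate l x)
  constant-nonIncreasing x i j _ = ≤-reflexive (trans (lookup-replicate j x) (sym (lookup-replicate i x)))

  -- Each step moves the leading weight onto the next (smaller) entry.
  abel-from : ∀ {l} (n : ℕ) (c : Vec ℤ l) (t : ℕ) (s : Vec ℕ l) (m : ℕ) →
    PartialSumsNonneg (toList (+ n ∷ c)) → AtLeast m (t ∷ s) → NonIncreasing (t ∷ s) →
    sumCoeffs (+ n ∷ c) * + m ≤ linear (+ n ∷ c) (t ∷ s)
  abel-from n [] t [] m _ m≤s _ = begin
    (+ n + + 0) * + m  ≡⟨ cong (_* + m) (+-identityʳ (+ n)) ⟩
    + n * + m          ≤⟨ *-monoˡ-≤-nonNeg (+ n) (+≤+ (m≤s Fin.zero)) ⟩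
    + n * + t          ≡⟨ +-identityʳ (+ n * + t) ⟨
    + n * + t + + 0    ∎
    where open ≤-Reasoning
  abel-from n (c ∷ cs) t (x ∷ s) m (_ , sums) m≤s dec with + n + c in n+c≡k
  abel-from n (c ∷ cs) t (x ∷ s) m (_ , () , _) m≤s dec | -[1+ _ ]
  abel-from n (c ∷ cs) t (x ∷ s) m (_ , sums) m≤s dec | + k = begin
    (+ n + (c + σ)) * + m      ≡⟨ cong (_* + m) (+-assoc (+ n) c σ) ⟨
    (+ n + c + σ) * + m        ≡⟨ cong (λ z → (z + σ) * + m) n+c≡k ⟩
    (+ k + σ) * + m            ≤⟨ abel-from k cs x s m sums (m≤s ∘ Fin.suc) (nonIncreasing-tail dec) ⟩
    + k * + x + L              ≡⟨ cong (λ z → z * + x + L) n+c≡k ⟨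
    (+ n + c) * + x + L        ≡⟨ cong (_+ L) (*-distribʳ-+ (+ x) (+ n) c) ⟩
    + n * + x + c * + x + L    ≡⟨ +-assoc (+ n * + x) (c * + x) L ⟩
    + n * + x + (c * + x + L)  ≤⟨ +-monoˡ-≤ (c * + x + L) (*-monoˡ-≤-nonNeg (+ n) (+≤+ (nonIncreasing-head dec))) ⟩
    + n * + t + (c * + x + L)  ∎
    where
    open ≤-Reasoning
    σ = sumCoeffs cs
    L = linear cs s

  abel : ∀ {l} (a : Vec ℤ l) (s : Vec ℕ l) (m : ℕ) →
    PartialSumsNonneg (toList a) → AtLeast m s → NonIncreasing s →
    sumCoeffs a * + m ≤ linear a s
  abel []              []      m _        = λ _ _ → +≤+ z≤n
  abel (+ n ∷ c)       (t ∷ s) m sums     = abel-from n c t s m sums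
  abel (-[1+ _ ] ∷ _)  _       m (() , _)

  sum-nonneg-from : ∀ {l} (n : ℕ) (c : Vec ℤ l) →
    PartialSumsNonneg (toList (+ n ∷ c)) → + 0 ≤ sumCoeffs (+ n ∷ c)
  sum-nonneg-from n [] _ = +≤+ z≤n
  sum-nonneg-from n (c ∷ cs) (_ , sums) with + n + c in n+c≡k
  sum-nonneg-from n (c ∷ cs) (_ , () , _) | -[1+ _ ]
  sum-nonneg-from n (c ∷ cs) (_ , sums) | + k =
    subst (+ 0 ≤_) (trans (cong (_+ sumCoeffs cs) (sym n+c≡k)) (+-assoc (+ n) c (sumCoeffs cs)))
      (sum-nonneg-from k cs sums)

  sum-nonneg : ∀ {l} (a : Vec ℤ l) → PartialSumsNonneg (toList a) → + 0 ≤ sumCoeffs a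
  sum-nonneg []             _        = +≤+ z≤n
  sum-nonneg (+ n ∷ c)      sums     = sum-nonneg-from n c sums
  sum-nonneg (-[1+ _ ] ∷ _) (() , _)

  -- The coefficients of p′ sum to σₙ − 1, and p(x, s) = x + p′(…):
  -- for a₁ = 1, p′ = Σᵢ₌₂ aᵢxᵢ; for a₁ ≠ 1, p′ has coefficients (a₁ − 1, a₂, …).
  drop-one : ∀ (σ : ℤ) → (+ 1 + σ) - + 1 ≡ σ
  drop-one = solve-∀

  shift-one : ∀ (a₁ σ : ℤ) → (a₁ + σ) - + 1 ≡ (a₁ - + 1) + σ
  shift-one = solve-∀

  peel-one : ∀ (a₁ x L : ℤ) → x + ((a₁ - + 1) * x + L) ≡ a₁ * x + L
  peel-one = solve-∀

  prime-sum : ∀ {k} (a : Vec ℤ (suc k)) → PartialSumsNonneg (coeffsPrime a) → + 0 ≤ sumCoeffs a - + 1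
  prime-sum (a₁ ∷ as) sums with a₁ ≟ℤ + 1
  ... | yes refl = subst (+ 0 ≤_) (sym (drop-one (sumCoeffs as))) (sum-nonneg as sums)
  ... | no _     = subst (+ 0 ≤_) (sym (shift-one a₁ (sumCoeffs as))) (sum-nonneg ((a₁ - + 1) ∷ as) sums)

  prime-bound : ∀ {k} (a : Vec ℤ (suc k)) (m x : ℕ) (s : Vec ℕ k) → PartialSumsNonneg (coeffsPrime a) →
    AtLeast m (x ∷ s) → NonIncreasing (x ∷ s) → + x + (sumCoeffs a - + 1) * + m ≤ linear a (x ∷ s)
  prime-bound (a₁ ∷ as) m x s sums m≤s dec with a₁ ≟ℤ + 1
  ... | yes refl = begin
    + x + ((+ 1 + σ) - + 1) * + m  ≡⟨ cong (λ z → + x + z * + m) (drop-one σ) ⟩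
    + x + σ * + m                  ≤⟨ +-monoʳ-≤ (+ x) (abel as s m sums (m≤s ∘ Fin.suc) (nonIncreasing-tail dec)) ⟩
    + x + L                        ≡⟨ cong (_+ L) (*-identityˡ (+ x)) ⟨
    + 1 * + x + L                  ∎
    where
    open ≤-Reasoning
    σ = sumCoeffs as
    L = linear as s
  ... | no _ = begin
    + x + ((a₁ + σ) - + 1) * + m   ≡⟨ cong (λ z → + x + z * + m) (shift-one a₁ σ) ⟩
    + x + ((a₁ - + 1) + σ) * + m   ≤⟨ +-monoʳ-≤ (+ x) (abel ((a₁ - + 1) ∷ as) (x ∷ s) m sums m≤s dec) ⟩
    + x + ((a₁ - + 1) * + x + L)   ≡⟨ peel-one a₁ (+ x) L ⟩
    a₁ * + x + L                   ∎
    where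
    open ≤-Reasoning
    σ = sumCoeffs as
    L = linear as s

  offset-nonneg : ∀ {n} (a : Vec ℤ n) a₀ m → + 0 ≤ sumCoeffs a - + 1 → Admissible a a₀ →
    AdmissibleMultiplicity a a₀ m → + 0 ≤ (sumCoeffs a - + 1) * + m + a₀
  offset-nonneg a a₀ m σ-1≥0 (_ , inj₁ a₀≥0) _ =
    +-mono-≤ (*-monoʳ-≤-nonNeg (+ m) σ-1≥0) a₀≥0
  offset-nonneg a a₀ m _ (_ , inj₂ σ>1) (_ , bound , _) =
    subst (λ z → + 0 ≤ (sumCoeffs a - + 1) * + m + z) (neg-involutive a₀) (i≤j⇒0≤j-i (bound σ>1))

  Dominating : ∀ {k} → ℕ → Vec ℤ (suc k) → ℤ → Set
  Dominating {k} m a a₀ = ∀ x (s : Vec ℕ k) → AtLeast m (x ∷ s) → NonIncreasing (x ∷ s) →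
    Σ ℕ λ e → evalPattern a a₀ (x ∷ s) ≡ + e × x ℕ.≤ e

  -- the key estimate: p(s) ≥ s₁ + ((σₙ − 1)·m + a₀) ≥ s₁
  dominating : ∀ {k} (a : Vec ℤ (suc k)) a₀ m → StronglyAdmissible a a₀ → AdmissibleMultiplicity a a₀ m →
    Dominating m a a₀
  dominating a a₀ m (adm , prime-sums) am x s m≤s dec with evalPattern a a₀ (x ∷ s) | x≤p
    where
    open ≤-Reasoning
    offset = (sumCoeffs a - + 1) * + m
    x≤p : + x ≤ evalPattern a a₀ (x ∷ s)
    x≤p = begin
      + x                    ≤⟨ i≤i+j (+ x) (offset + a₀) {{nonNegative (offset-nonneg a a₀ m (prime-sum a prime-sums) adm am)}} ⟩
      + x + (offset + a₀)    ≡⟨ +-assoc (+ x) offset a₀ ⟨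
      + x + offset + a₀      ≤⟨ +-monoˡ-≤ a₀ (prime-bound a m x s prime-sums m≤s dec) ⟩
      linear a (x ∷ s) + a₀  ∎
  ... | + e | +≤+ x≤e = e , refl , x≤e

  linear-∣ : ∀ {l} (d : ℕ) (c : Vec ℤ l) (s : Vec ℕ l) → (∀ i → d ∣ lookup s i) → + d ∣ℤ linear c s
  linear-∣ d []       []      _   = ∣ᵤ⇒∣ (d ∣0)
  linear-∣ d (c ∷ cs) (x ∷ s) d∣s =
    ∣m∣n⇒∣m+n (∣n⇒∣m*n c (∣ᵤ⇒∣ (d∣s Fin.zero))) (linear-∣ d cs s (d∣s ∘ Fin.suc))

  pattern-∣ : ∀ {l} (d : ℕ) (a : Vec ℤ l) a₀ s → (∀ i → d ∣ lookup s i) → + d ∣ℤ a₀ → + d ∣ℤ evalPattern a a₀ s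
  pattern-∣ d a a₀ s d∣s d∣a₀ = ∣m∣n⇒∣m+n (linear-∣ d a s d∣s) d∣a₀

  pattern-∣⁻¹ : ∀ {l} (d : ℕ) (a : Vec ℤ l) a₀ s → (∀ i → d ∣ lookup s i) → + d ∣ℤ evalPattern a a₀ s → + d ∣ℤ a₀
  pattern-∣⁻¹ d a a₀ s d∣s d∣p = ∣m+n∣m⇒∣n d∣p (linear-∣ d a s d∣s)

open PatternBounds

open import Data.Nat using (_+_; _*_; _≤_; _<_; NonZero; >-nonZero; ≢-nonZero; _≤?_; _<?_)
open import Data.Nat.Divisibility using (_∣?_; ∣m∣n⇒∣m+n; ∣m+n∣m⇒∣n; m∣m*n; ∣1⇒≡1)
open import Data.Nat.Properties
  using (≤-refl; ≤-trans; ≤-<-trans; <-≤-trans; ≤⇒≯; ≮⇒≥; ≰⇒>; n<1+n; n≤1+n; m≤m+n; m≤n+m; m≤n*m; +-identityʳ; _≟_)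

-- Arithmetic behind the Frobenius-type bound: an element c ≡ ±1 (mod m)
-- together with m generates every large X as j·c + w·m.
module Combinations where

  open import Data.Nat using (_∸_)
  open import Data.Nat.Properties using (<⇒≤; m∸n≤m; m+[n∸m]≡n; *-monoˡ-≤; +-cancelʳ-≡)
  open import Data.Nat.DivMod using (_%_; _/_; m≡m%n+[m/n]*n; m%n<n; m*n/n≡m; /-monoˡ-≤)
  open import Data.Nat.Tactic.RingSolver using (solve-∀)

  quotient-bound : ∀ m x X .{{_ : NonZero m}} → (m * x) * m ≤ X → m * x ≤ X / m
  quotient-bound m x X h = subst (_≤ X / m) (m*n/n≡m (m * x) m) (/-monoˡ-≤ m h)

  combination-plus : ∀ m c x X .{{_ : NonZero m}} → 1 + x * m ≡ c → (m * x) * m ≤ X →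
    ∃₂ λ j w → j * c + w * m ≡ X
  combination-plus m c x X c≡ X≥ = r , w , (begin
    r * c + w * m              ≡⟨ cong (λ z → r * z + w * m) c≡ ⟨
    r * (1 + x * m) + w * m    ≡⟨ regroup r x w m ⟩
    r + (r * x + w) * m        ≡⟨ cong (λ z → r + z * m) (m+[n∸m]≡n rx≤q) ⟩
    r + q * m                  ≡⟨ m≡m%n+[m/n]*n X m ⟨
    X                          ∎)
    where
    open ≡-Reasoning
    r = X % m
    q = X / m
    rx≤q : r * x ≤ q
    rx≤q = ≤-trans (*-monoˡ-≤ x (<⇒≤ (m%n<n X m))) (quotient-bound m x X X≥)
    w = q ∸ r * x
    regroup : ∀ r x w m → r * (1 + x * m) + w * m ≡ r + (r * x + w) * m
    regroup = solve-∀

  combination-minus : ∀ m c x X .{{_ : NonZero m}} → 1 + c ≡ x * m → (m * x) * m ≤ X →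
    ∃₂ λ j w → j * c + w * m ≡ X
  combination-minus m c x X c≡ X≥ = j , w , +-cancelʳ-≡ j _ _ (begin
    j * c + w * m + j          ≡⟨ regroup₁ j c w m ⟩
    j * (1 + c) + w * m        ≡⟨ cong (λ z → j * z + w * m) c≡ ⟩
    j * (x * m) + w * m        ≡⟨ regroup₂ j x w m ⟩
    (j * x + w) * m            ≡⟨ cong (_* m) (m+[n∸m]≡n jx≤1+q) ⟩
    suc q * m                  ≡⟨ cong (λ z → z + q * m) (m+[n∸m]≡n r≤m) ⟨
    r + j + q * m              ≡⟨ regroup₃ r j q m ⟩
    r + q * m + j              ≡⟨ cong (_+ j) (m≡m%n+[m/n]*n X m) ⟨
    X + j                      ∎)
    where
    open ≡-Reasoning
    r = X % m
    q = X / m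
    j = m ∸ r
    r≤m : r ≤ m
    r≤m = <⇒≤ (m%n<n X m)
    jx≤1+q : j * x ≤ suc q
    jx≤1+q = ≤-trans (*-monoˡ-≤ x (m∸n≤m m r)) (≤-trans (quotient-bound m x X X≥) (n≤1+n q))
    w = suc q ∸ j * x
    regroup₁ : ∀ j c w m → j * c + w * m + j ≡ j * (1 + c) + w * m
    regroup₁ = solve-∀
    regroup₂ : ∀ j x w m → j * (x * m) + w * m ≡ (j * x + w) * m
    regroup₂ = solve-∀
    regroup₃ : ∀ r j q m → r + j + q * m ≡ r + q * m + j
    regroup₃ = solve-∀

open Combinations using (combination-plus; combination-minus)
open Bézout.Identity using (+-; -+)

multiple∈ : ∀ Λ {c} j → mem Λ c ≡ true → mem Λ (j * c) ≡ true
multiple∈ Λ zero    _  = zero∈ Λ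
multiple∈ Λ (suc j) c∈ = closed Λ _ _ c∈ (multiple∈ Λ j c∈)

combination∈ : ∀ Λ {c m X} → mem Λ c ≡ true → mem Λ m ≡ true →
  ∃₂ (λ j w → j * c + w * m ≡ X) → mem Λ X ≡ true
combination∈ Λ c∈ m∈ (j , w , refl) = closed Λ _ _ (multiple∈ Λ j c∈) (multiple∈ Λ w m∈)

multiplicity-≤ : ∀ Λ {m x} → HasMultiplicity Λ m → 1 ≤ x → mem Λ x ≡ true → m ≤ x
multiplicity-≤ Λ (_ , _ , below) 1≤x x∈ = ≮⇒≥ λ x<m → contradiction (trans (sym x∈) (below _ 1≤x x<m)) λ ()

-- If gcd(m, e) = 1, every semigroup containing m and e contains all X ≥ B,
-- where B depends only on m and e: by Bézout some multiple y·e is ≡ ±1 (mod m).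
coprime-conductor : ∀ m e .{{_ : NonZero m}} → Coprime m e →
  Σ ℕ λ B → ∀ Λ → mem Λ m ≡ true → mem Λ e ≡ true → ∀ X → B ≤ X → mem Λ X ≡ true
coprime-conductor m e coprime with coprime-Bézout coprime
... | -+ x y 1+xm≡ye = (m * x) * m , λ Λ m∈ e∈ X X≥B →
  combination∈ Λ (multiple∈ Λ y e∈) m∈ (combination-plus m (y * e) x X 1+xm≡ye X≥B)
... | +- x y 1+ye≡xm = (m * x) * m , λ Λ m∈ e∈ X X≥B →
  combination∈ Λ (multiple∈ Λ y e∈) m∈ (combination-minus m (y * e) x X 1+ye≡xm X≥B)

FinitelyMany : (NumericalSemigroup → Set) → Set
FinitelyMany S = Σ (List NumericalSemigroup) λ L →
  (∀ Λ → Λ ∈ L → S Λ) × (∀ Λ → S Λ → Σ NumericalSemigroup λ Λ′ → Λ′ ∈ L × Λ ≈NS Λ′)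

boolVectors : (n : ℕ) → List (Vec Bool n)
boolVectors zero    = [ [] ]
boolVectors (suc n) = map (true ∷_) (boolVectors n) ++ map (false ∷_) (boolVectors n)

∈-boolVectors : ∀ {n} (v : Vec Bool n) → v ∈ boolVectors n
∈-boolVectors []          = here refl
∈-boolVectors (true ∷ v)  = ∈-++⁺ˡ (∈-map⁺ (true ∷_) (∈-boolVectors v))
∈-boolVectors (false ∷ v) = ∈-++⁺ʳ (map (true ∷_) _) (∈-map⁺ (false ∷_) (∈-boolVectors v))

Realisers : {A B : Set} (S : B → Set) (R : A → B → Set) → List A → Set
Realisers {B = B} S R codes = Σ (List B) λ L → (∀ b → b ∈ L → S b) ×
  (∀ v → v ∈ codes → ∀ b → S b → R v b → Σ B λ b′ → b′ ∈ L × R v b′)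

-- Such a list exists up to double negation: deciding, for each code, whether
-- it is realised is an instance of excluded middle.
¬¬-realisers : {A B : Set} (S : B → Set) (R : A → B → Set) (codes : List A) → ¬ ¬ Realisers S R codes
¬¬-realisers S R []          k = k ([] , (λ _ ()) , (λ _ ()))
¬¬-realisers {B = B} S R (v ∷ codes) k =
  ¬¬-realisers S R codes λ found → ¬¬-excluded-middle λ realised? → k (extend found realised?)
  where
  extend : Realisers S R codes → Dec (Σ B λ b → S b × R v b) → Realisers S R (v ∷ codes)
  extend (L , L⊆S , covers) (yes (b , Sb , Rvb)) = b ∷ L , extended-⊆ , extended-covers
    where
    extended-⊆ : ∀ b′ → b′ ∈ b ∷ L → S b′
    extended-⊆ _  (here refl)  = Sb
    extended-⊆ b′ (there b′∈L) = L⊆S b′ b′∈L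
    extended-covers : ∀ v′ → v′ ∈ v ∷ codes → ∀ b′ → S b′ → R v′ b′ → Σ B λ b″ → b″ ∈ b ∷ L × R v′ b″
    extended-covers _  (here refl)   _  _   _   = b , here refl , Rvb
    extended-covers v′ (there v′∈) b′ Sb′ Rb′ with covers v′ v′∈ b′ Sb′ Rb′
    ... | b″ , b″∈L , Rb″ = b″ , there b″∈L , Rb″
  extend (L , L⊆S , covers) (no unrealised) = L , L⊆S , covers′
    where
    covers′ : ∀ v′ → v′ ∈ v ∷ codes → ∀ b′ → S b′ → R v′ b′ → Σ B λ b″ → b″ ∈ L × R v′ b″
    covers′ _  (here refl) b′ Sb′ Rb′ = ⊥-elim (unrealised (b′ , Sb′ , Rb′))
    covers′ v′ (there v′∈)            = covers v′ v′∈

profile : (B : ℕ) → NumericalSemigroup → Vec Bool B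
profile B Λ = tabulate (λ i → mem Λ (toℕ i))

profile-mem : ∀ B Λ Λ′ → profile B Λ ≡ profile B Λ′ → ∀ x → x < B → mem Λ x ≡ mem Λ′ x
profile-mem B Λ Λ′ same x x<B = begin
  mem Λ x                 ≡⟨ cong (mem Λ) (toℕ-fromℕ< x<B) ⟨
  mem Λ (toℕ i)           ≡⟨ lookup∘tabulate _ i ⟨
  lookup (profile B Λ) i  ≡⟨ cong (λ v → lookup v i) same ⟩
  lookup (profile B Λ′) i ≡⟨ lookup∘tabulate _ i ⟩
  mem Λ′ (toℕ i)          ≡⟨ cong (mem Λ′) (toℕ-fromℕ< x<B) ⟩
  mem Λ′ x                ∎
  where
  open ≡-Reasoning
  i = fromℕ< x<B

agree-below : ∀ B Λ Λ′ → (∀ x → x < B → mem Λ x ≡ mem Λ′ x) →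
  (∀ x → B ≤ x → mem Λ x ≡ true) → (∀ x → B ≤ x → mem Λ′ x ≡ true) → Λ ≈NS Λ′
agree-below B Λ Λ′ below full full′ x with x <? B
... | yes x<B = below x x<B
... | no  x≮B = trans (full x (≮⇒≥ x≮B)) (sym (full′ x (≮⇒≥ x≮B)))

-- A family whose members all contain [B, ∞) is (not not) finite: a member is
-- determined by its profile below B, and there are finitely many profiles.
uniform-conductor⇒¬¬finite : ∀ (S : NumericalSemigroup → Set) B →
  (∀ Λ → S Λ → ∀ x → B ≤ x → mem Λ x ≡ true) → ¬ ¬ FinitelyMany S
uniform-conductor⇒¬¬finite S B full =
  ¬¬-map finite (¬¬-realisers S (λ v Λ → profile B Λ ≡ v) (boolVectors B))
  where
  finite : Realisers S (λ v Λ → profile B Λ ≡ v) (boolVectors B) → FinitelyMany S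
  finite (L , L⊆S , covers) = L , L⊆S , represent
    where
    represent : ∀ Λ → S Λ → Σ NumericalSemigroup λ Λ′ → Λ′ ∈ L × Λ ≈NS Λ′
    represent Λ SΛ with covers (profile B Λ) (∈-boolVectors _) Λ SΛ refl
    ... | Λ′ , Λ′∈L , same = Λ′ , Λ′∈L ,
      agree-below B Λ Λ′ (profile-mem B Λ Λ′ (sym same)) (full Λ SΛ) (full Λ′ (L⊆S Λ′ Λ′∈L))

-- A family with gaps arbitrarily far out is infinite: a finite list has a
-- common bound M for the cofiniteness witnesses of its members.
unbounded-gaps⇒infinite : ∀ (S : NumericalSemigroup → Set) →
  (∀ M → Σ NumericalSemigroup λ Λ → S Λ × Σ ℕ λ x → M ≤ x × mem Λ x ≡ false) → ¬ FinitelyMany S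
unbounded-gaps⇒infinite S gaps (L , _ , covers)
  with gaps (max 0 (map (proj₁ ∘ cofinite) L))
... | Λ , SΛ , x , M≤x , x∉Λ with covers Λ SΛ
... | Λ′ , Λ′∈L , Λ≈Λ′ = contradiction (trans (sym x∉Λ) (trans (Λ≈Λ′ x) x∈Λ′)) λ ()
  where
  bound≤M : proj₁ (cofinite Λ′) ≤ max 0 (map (proj₁ ∘ cofinite) L)
  bound≤M = All.lookup (xs≤max 0 (map (proj₁ ∘ cofinite) L)) (∈-map⁺ (proj₁ ∘ cofinite) Λ′∈L)
  x∈Λ′ : mem Λ′ x ≡ true
  x∈Λ′ = proj₂ (cofinite Λ′) x (≤-trans bound≤M M≤x)

dec-true⁻¹ : ∀ {A : Set} (a? : Dec A) → does a? ≡ true → A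
dec-true⁻¹ (yes a) _ = a
dec-true⁻¹ (no _)  ()

module DivisibleTail (d m N : ℕ) where

  Member : ℕ → Set
  Member x = x ≡ 0 ⊎ (m ≤ x × d ∣ x) ⊎ N ≤ x

  member? : ∀ x → Dec (Member x)
  member? x = x ≟ 0 ⊎-dec ((m ≤? x) ×-dec (d ∣? x)) ⊎-dec (N ≤? x)

  member-+ : ∀ {x y} → Member x → Member y → Member (x + y)
  member-+ (inj₁ refl) y∈ = y∈
  member-+ {x} x∈ (inj₁ refl) = subst Member (sym (+-identityʳ x)) x∈
  member-+ {x} {y} (inj₂ (inj₂ N≤x)) _ = inj₂ (inj₂ (≤-trans N≤x (m≤m+n x y)))
  member-+ {x} {y} _ (inj₂ (inj₂ N≤y)) = inj₂ (inj₂ (≤-trans N≤y (m≤n+m y x)))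
  member-+ {x} {y} (inj₂ (inj₁ (m≤x , d∣x))) (inj₂ (inj₁ (_ , d∣y))) =
    inj₂ (inj₁ (≤-trans m≤x (m≤m+n x y) , ∣m∣n⇒∣m+n d∣x d∣y))

  member⁻¹ : ∀ x → does (member? x) ≡ true → Member x
  member⁻¹ x = dec-true⁻¹ (member? x)

  semigroup : NumericalSemigroup
  semigroup = record
    { mem      = λ x → does (member? x)
    ; zero∈    = dec-true (member? 0) (inj₁ refl)
    ; closed   = λ x y x∈ y∈ → dec-true (member? (x + y)) (member-+ (member⁻¹ x x∈) (member⁻¹ y y∈))
    ; cofinite = N , λ x N≤x → dec-true (member? x) (inj₂ (inj₂ N≤x))
    }

  non-member : ∀ {x} → 1 ≤ x → ¬ (m ≤ x × d ∣ x) → x < N → mem semigroup x ≡ false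
  non-member {x} 1≤x not-middle x<N = dec-false (member? x) λ where
    (inj₁ refl)         → contradiction 1≤x λ ()
    (inj₂ (inj₁ middle)) → not-middle middle
    (inj₂ (inj₂ N≤x))   → contradiction x<N (≤⇒≯ N≤x)

  small-member-∣ : ∀ {x} → 1 ≤ x → x < N → Member x → d ∣ x
  small-member-∣ 1≤x x<N (inj₁ refl)              = contradiction 1≤x λ ()
  small-member-∣ 1≤x x<N (inj₂ (inj₁ (_ , d∣x)))  = d∣x
  small-member-∣ 1≤x x<N (inj₂ (inj₂ N≤x))        = contradiction x<N (≤⇒≯ N≤x)

  multiplicity : 1 ≤ m → d ∣ m → m ≤ N → HasMultiplicity semigroup m
  multiplicity 1≤m d∣m m≤N = 1≤m , dec-true (member? m) (inj₂ (inj₁ (≤-refl , d∣m))) ,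
    λ x 1≤x x<m → non-member 1≤x (λ (m≤x , _) → contradiction x<m (≤⇒≯ m≤x)) (<-≤-trans x<m m≤N)

  -- The semigroup admits every pattern that dominates its inputs and whose
  -- constant term is divisible by d: inputs below N are multiples of d, so
  -- their value is one too, and inputs reaching N have values ≥ N.
  admits : ∀ {k} (a : Vec ℤ (suc k)) a₀ → 1 ≤ m → d ∣ m → m ≤ N → + d ∣ℤ a₀ → Dominating m a a₀ →
    Admits semigroup a a₀
  admits a a₀ 1≤m d∣m m≤N d∣a₀ dom (x ∷ s) pos s∈ dec = value∈ (dom x s atLeast dec)
    where
    atLeast : AtLeast m (x ∷ s)
    atLeast i = multiplicity-≤ semigroup (multiplicity 1≤m d∣m m≤N) (pos i) (s∈ i)
    entry-∣ : x < N → ∀ i → d ∣ lookup (x ∷ s) i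
    entry-∣ x<N i =
      small-member-∣ (pos i) (≤-<-trans (dec Fin.zero i z≤n) x<N) (member⁻¹ (lookup (x ∷ s) i) (s∈ i))
    value∈ : Σ ℕ (λ e → evalPattern a a₀ (x ∷ s) ≡ + e × x ≤ e) → evalPattern a a₀ (x ∷ s) ∈ℤ semigroup
    value∈ (e , p≡e , x≤e) = subst (_∈ℤ semigroup) (sym p≡e) (dec-true (member? e) value-member)
      where
      value-member : Member e
      value-member with N ≤? x
      ... | yes N≤x = inj₂ (inj₂ (≤-trans N≤x x≤e))
      ... | no  N≰x = inj₂ (inj₁ (≤-trans (atLeast Fin.zero) x≤e ,
                        ∣⇒∣ᵤ (subst (+ d ∣ℤ_) p≡e (pattern-∣ d a a₀ (x ∷ s) (entry-∣ (≰⇒> N≰x)) d∣a₀))))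

admits-constant : ∀ {n} Λ (a : Vec ℤ n) a₀ m → Admits Λ a a₀ → 1 ≤ m → mem Λ m ≡ true →
  evalPattern a a₀ (replicate n m) ∈ℤ Λ
admits-constant Λ a a₀ m adm 1≤m m∈ = adm (replicate _ m)
  (λ i → subst (1 ≤_) (sym (lookup-replicate i m)) 1≤m)
  (λ i → subst (λ z → mem Λ z ≡ true) (sym (lookup-replicate i m)) m∈)
  (constant-nonIncreasing m)

-- a common divisor of m and p(m, …, m) divides a₀, hence gcd(m, a₀) = 1 makes them coprime
constant-value-coprime : ∀ {n} (a : Vec ℤ n) a₀ m e → evalPattern a a₀ (replicate n m) ≡ + e →
  gcd m ∣ a₀ ∣ ≡ 1 → Coprime m e
constant-value-coprime a a₀ m e p≡e gcd≡1 {d} (d∣m , d∣e) = ∣1⇒≡1 (subst (d ∣_) gcd≡1 (gcd-greatest d∣m d∣a₀))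
  where
  d∣a₀ : d ∣ ∣ a₀ ∣
  d∣a₀ = ∣⇒∣ᵤ (pattern-∣⁻¹ d a a₀ (replicate _ m) (λ i → subst (d ∣_) (sym (lookup-replicate i m)) d∣m)
                  (subst (+ d ∣ℤ_) (sym p≡e) (∣ᵤ⇒∣ d∣e)))

-- If gcd(m, a₀) = 1, all members of 𝒮ₘ(p) contain [B, ∞) for a single B:
-- they all contain m and e = p(m, …, m), which are coprime.
uniform-conductor : ∀ {k} (a : Vec ℤ (suc k)) a₀ m → StronglyAdmissible a a₀ → AdmissibleMultiplicity a a₀ m →
  gcd m ∣ a₀ ∣ ≡ 1 → Σ ℕ λ B → ∀ Λ → InS m a a₀ Λ → ∀ X → B ≤ X → mem Λ X ≡ true
uniform-conductor {k} a a₀ m sa am@(1≤m , _) gcd≡1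
  with dominating a a₀ m sa am m (replicate k m) (constant-atLeast m) (constant-nonIncreasing m)
... | e , p≡e , _ with coprime-conductor m e {{>-nonZero 1≤m}} (constant-value-coprime a a₀ m e p≡e gcd≡1)
... | B , conductor = B , λ Λ ((_ , m∈ , _) , adm) →
  conductor Λ m∈ (subst (_∈ℤ Λ) p≡e (admits-constant Λ a a₀ m adm 1≤m m∈))

-- gcd(m, a₀) = d ≠ 1: the semigroups {0} ∪ {x ≥ m : d ∣ x} ∪ [N, ∞) lie in
-- 𝒮ₘ(p) and have the gap d·(M + m) + 1 ≥ M for N just above it.
gaps-beyond : ∀ {k} (a : Vec ℤ (suc k)) a₀ m → StronglyAdmissible a a₀ → AdmissibleMultiplicity a a₀ m →
  ¬ gcd m ∣ a₀ ∣ ≡ 1 → ∀ M → Σ NumericalSemigroup λ Λ → InS m a a₀ Λ × Σ ℕ λ x → M ≤ x × mem Λ x ≡ false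
gaps-beyond a a₀ m sa am@(1≤m , _) gcd≢1 M =
  semigroup , (multiplicity 1≤m d∣m m≤N , admits a a₀ 1≤m d∣m m≤N d∣a₀ (dominating a a₀ m sa am)) ,
  x , ≤-trans (m≤m+n M m) M+m≤x , non-member 1≤x (d∤x ∘ proj₂) (n<1+n x)
  where
  d = gcd m ∣ a₀ ∣
  d∣m : d ∣ m
  d∣m = gcd[m,n]∣m m ∣ a₀ ∣
  d∣a₀ : + d ∣ℤ a₀
  d∣a₀ = ∣ᵤ⇒∣ (gcd[m,n]∣n m ∣ a₀ ∣)
  instance
    d-nonZero : NonZero d
    d-nonZero = ≢-nonZero λ d≡0 → contradiction (subst (1 ≤_) (gcd[m,n]≡0⇒m≡0 d≡0) 1≤m) λ ()
  x = d * (M + m) + 1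
  N = suc x
  open DivisibleTail d m N
  M+m≤x : M + m ≤ x
  M+m≤x = ≤-trans (m≤n*m (M + m) d) (m≤m+n (d * (M + m)) 1)
  m≤N : m ≤ N
  m≤N = ≤-trans (m≤n+m m M) (≤-trans M+m≤x (n≤1+n x))
  1≤x : 1 ≤ x
  1≤x = m≤n+m 1 (d * (M + m))
  d∤x : ¬ d ∣ x
  d∤x d∣x = gcd≢1 (∣1⇒≡1 (∣m+n∣m⇒∣n d∣x (m∣m*n (M + m))))

-- Theorem 5.
mainTheorem5 : (k : ℕ) (a : Vec ℤ (suc k)) (a₀ : ℤ) (m : ℕ) →
    IsPattern a a₀ → StronglyAdmissible a a₀ → AdmissibleMultiplicity a a₀ m →
    (InfiniteS m a a₀ → ¬ gcd m ∣ a₀ ∣ ≡ 1) × (¬ gcd m ∣ a₀ ∣ ≡ 1 → InfiniteS m a a₀)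
mainTheorem5 k a a₀ m _ sa am = infinite⇒gcd≢1 , gcd≢1⇒infinite
  where
  infinite⇒gcd≢1 : InfiniteS m a a₀ → ¬ gcd m ∣ a₀ ∣ ≡ 1
  infinite⇒gcd≢1 infinite gcd≡1 =
    let (B , full) = uniform-conductor a a₀ m sa am gcd≡1
    in uniform-conductor⇒¬¬finite (InS m a a₀) B full infinite
  gcd≢1⇒infinite : ¬ gcd m ∣ a₀ ∣ ≡ 1 → InfiniteS m a a₀
  gcd≢1⇒infinite gcd≢1 = unbounded-gaps⇒infinite (InS m a a₀) (gaps-beyond a a₀ m sa am gcd≢1)
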